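{- Let $X$ be a finite connected vertex-transitive graph with at least $3$ vertices, and let $G$ be a group of automorphisms of $X$ acting transitively on $V(X)$ such that $G'$ is cyclic of order $p^k$ for a prime $p$, and such that $X$ is $G$-minimal. If $H$ is a normal subgroup of $G$ with $H \subseteq \Phi(G)$, then the quotient graph $X/H$ is $G$-minimal.
   Context: $G'$ is the commutator subgroup of $G$; $\Phi(G)$ is the Frattini subgroup (the set of nongenerators of $G$, where $g$ is a nongenerator if $\langle S,g\rangle=G$ implies $\langle S\rangle = G$ for every $S \subseteq G$). For a subgroup $H$, the $H$-orbit of $x$ is $Hx = \{hx: h\in H\}$; the quotient graph $X/H$ has the $H$-orbits as vertices, with $Hx$, $Hy$ adjacent iff some edge of $X$ joins a vertex of $Hx$ to a vertex of $Hy$ (a loop if $Hx = Hy$). When $H$ is normal, $G$ acts on $X/H$ by $g(Hx) = H(gx)$. A graph $Z$ on which $G$ acts by automorphisms is $G$-minimal if every connected spanning subgraph $Y$ of $Z$ with $gY=Y$ for all $g\in G$ equals $Z$. -}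

module Defs where

open import Level using (0ℓ)
open import Algebra.Bundles using (Group)
open import Data.Nat using (ℕ; _≤_)
open import Data.Fin using (Fin)
open import Data.Product using (Σ; ∃; ∃₂; _×_; _,_)
open import Data.Sum using (_⊎_)
open import Relation.Unary using (Pred)
open import Relation.Binary.Construct.Closure.ReflexiveTransitive using (Star)
open import Relation.Binary.PropositionalEquality using (_≡_)
open import Relation.Nullary using (¬_)
open import Function.Bundles using (_⇔_)

module _ (G : Group 0ℓ 0ℓ) where
  open Group G

  data Gen (S : Pred Carrier 0ℓ) : Pred Carrier 0ℓ where
    gen   : ∀ {x} → S x → Gen S x
    gen-ε : Gen S ε
    gen-∙ : ∀ {x y} → Gen S x → Gen S y → Gen S (x ∙ y)
    gen-⁻¹ : ∀ {x} → Gen S x → Gen S (x ⁻¹)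
    gen-≈ : ∀ {x y} → x ≈ y → Gen S x → Gen S y

  record IsSubgroup (H : Pred Carrier 0ℓ) : Set where
    field
      resp  : ∀ {x y} → x ≈ y → H x → H y
      has-ε : H ε
      ∙-closed : ∀ {x y} → H x → H y → H (x ∙ y)
      ⁻¹-closed : ∀ {x} → H x → H (x ⁻¹)

  record IsNormalSubgroup (H : Pred Carrier 0ℓ) : Set where
    field
      isSubgroup : IsSubgroup H
      conj-closed : ∀ g {h} → H h → H (g ∙ h ∙ g ⁻¹)

  Commutators : Pred Carrier 0ℓ
  Commutators g = ∃₂ λ a b → g ≈ a ⁻¹ ∙ b ⁻¹ ∙ a ∙ b

  Derived : Pred Carrier 0ℓ
  Derived = Gen Commutators

  Generates : Pred Carrier 0ℓ → Set
  Generates S = ∀ x → Gen S x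

  -- g is a nongenerator: ⟨S,g⟩ = G implies ⟨S⟩ = G for every S ⊆ G
  -- Frattini subgroup Φ(G) = set of nongenerators
  Frattini : Carrier → Set₁
  Frattini g = ∀ (S : Pred Carrier 0ℓ) →
               Generates (λ x → S x ⊎ x ≈ g) → Generates S

  HasOrder : Pred Carrier 0ℓ → ℕ → Set
  HasOrder P m = Σ (Fin m → Carrier) λ f →
      (∀ i → P (f i))
    × (∀ i j → f i ≈ f j → i ≡ j)
    × (∀ x → P x → ∃ λ i → f i ≈ x)

  IsCyclicOfOrder : Pred Carrier 0ℓ → ℕ → Set
  IsCyclicOfOrder P m =
    (∃ λ c → ∀ x → P x ⇔ Gen (λ y → y ≈ c) x) × HasOrder P m

  record IsFaithfulAction (n : ℕ) (act : Carrier → Fin n → Fin n) : Set where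
    field
      act-ε : ∀ x → act ε x ≡ x
      act-∙ : ∀ g h x → act (g ∙ h) x ≡ act g (act h x)
      act-≈ : ∀ {g h} → g ≈ h → ∀ x → act g x ≡ act h x
      faithful : ∀ g h → (∀ x → act g x ≡ act h x) → g ≈ h

  OrbitRel : ∀ {n} → (Carrier → Fin n → Fin n) → Pred Carrier 0ℓ →
             Fin n → Fin n → Set
  OrbitRel act H x y = ∃ λ h → H h × act h x ≡ y

Symmetric : ∀ {n} → (Fin n → Fin n → Set) → Set
Symmetric E = ∀ {x y} → E x y → E y x

record IsSimpleGraph {n : ℕ} (E : Fin n → Fin n → Set) : Set where
  field
    sym    : Symmetric E
    irrefl : ∀ x → ¬ E x x

Connected : ∀ {n} → (Fin n → Fin n → Set) → Set
Connected E = ∀ x y → Star E x y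

IsAutomorphism : ∀ {n} → (Fin n → Fin n → Set) → (Fin n → Fin n) → Set
IsAutomorphism {n} E σ = Σ (Fin n → Fin n) λ τ →
    (∀ x → τ (σ x) ≡ x) × (∀ x → σ (τ x) ≡ x)
  × (∀ x y → E x y ⇔ E (σ x) (σ y))

VertexTransitive : ∀ {n} → (Fin n → Fin n → Set) → Set
VertexTransitive E = ∀ x y → ∃ λ σ → IsAutomorphism E σ × σ x ≡ y

-- Graphs whose vertices are the classes of an equivalence relation _~_
-- on Fin n (used for quotient graphs X/H; for X itself _~_ is _≡_).
-- Adj is the adjacency on classes, expressed on representatives.
-- act is an action of some group (index type A) on representatives.

GMinimal : ∀ {n} {A : Set} → (A → Fin n → Fin n) →
           (_~_ : Fin n → Fin n → Set) → (Adj : Fin n → Fin n → Set) → Set₁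
GMinimal {n} act _~_ Adj =
  ∀ (Y : Fin n → Fin n → Set) →
    (∀ {x y} → Y x y → Adj x y) →
    (∀ {x x′ y y′} → x ~ x′ → y ~ y′ → Y x y → Y x′ y′) →
    Symmetric Y →
    (∀ x y → Star (λ a b → Y a b ⊎ a ~ b) x y) →
    (∀ g x y → Y x y ⇔ Y (act g x) (act g y)) →
    ∀ x y → Adj x y → Y x y

-- quotient graph X/H: Hx adjacent to Hy iff some edge of X joins a
-- vertex of Hx to a vertex of Hy (loops allowed)
QuotientAdj : ∀ {n} {A : Set} → (A → Fin n → Fin n) → (A → Set) →
              (Fin n → Fin n → Set) → Fin n → Fin n → Set
QuotientAdj act H E x y =
  ∃₂ λ x′ y′ → (∃ λ h → H h × act h x ≡ x′)
             × (∃ λ h → H h × act h y ≡ y′) × E x′ y′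

module Submission where

-- Let Y be a G-invariant connected spanning subgraph of X/H and let Ỹ = X ∩ Y be
-- the edges of X lying over edges of Y. Lifting paths of X/H shows that every
-- vertex is joined in Ỹ to some h x₀ with h ∈ H. The g with x₀ joined to g x₀
-- form a subgroup K, which together with these finitely many h generates G; as
-- each h is a nongenerator, K = G. Hence Ỹ is a G-invariant connected spanning
-- subgraph of X, so Ỹ = X by G-minimality, and therefore Y = X/H.

open import Defs
open import Level using (0ℓ)
open import Algebra.Bundles using (Group)
open import Data.Nat using (ℕ; _≤_; _^_)
open import Data.Nat.Primality using (Prime)
open import Data.Fin using (Fin)
open import Data.Product using (∃; _×_; _,_; proj₁; proj₂)
open import Data.Product.Function.NonDependent.Propositional using (_×-⇔_)
open import Data.Sum using (_⊎_; inj₁; inj₂)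
open import Data.List using (List; []; _∷_; map; allFin)
open import Data.List.Relation.Unary.Any as Any using (here; there)
open import Data.List.Relation.Unary.All using (All; []; _∷_; universal)
open import Data.List.Relation.Unary.All.Properties using (map⁺)
open import Data.List.Membership.Propositional.Properties using (∈-map⁺; ∈-allFin)
open import Relation.Unary using (Pred; _⊆_; _∪_)
open import Relation.Binary.Construct.Intersection using (_∩_)
open import Relation.Binary.Construct.Closure.ReflexiveTransitive
  using (Star; ε; _◅_; _◅◅_; gmap; reverse)
open import Relation.Binary.PropositionalEquality using (_≡_; refl; sym; trans; subst)
open import Function using (id)
open import Function.Bundles using (_⇔_; Equivalence)

module Generation (G : Group 0ℓ 0ℓ) where
  open Group G
  open import Algebra.Properties.Group G using (\\-leftDividesˡ)
  open import Data.List.Membership.Setoid setoid using (_∈_)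

  Gen-bind : ∀ {S T : Pred Carrier 0ℓ} → S ⊆ Gen G T → Gen G S ⊆ Gen G T
  Gen-bind f (gen s)     = f s
  Gen-bind f gen-ε       = gen-ε
  Gen-bind f (gen-∙ a b) = gen-∙ (Gen-bind f a) (Gen-bind f b)
  Gen-bind f (gen-⁻¹ a)  = gen-⁻¹ (Gen-bind f a)
  Gen-bind f (gen-≈ e a) = gen-≈ e (Gen-bind f a)

  Gen-closed : ∀ {K} → IsSubgroup G K → Gen G K ⊆ K
  Gen-closed {K} K-sub = closed
    where
    open IsSubgroup K-sub

    closed : Gen G K ⊆ K
    closed (gen k)     = k
    closed gen-ε       = has-ε
    closed (gen-∙ a b) = ∙-closed (closed a) (closed b)
    closed (gen-⁻¹ a)  = ⁻¹-closed (closed a)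
    closed (gen-≈ e a) = resp e (closed a)

  generates-∪-cosetReps : ∀ (K : Pred Carrier 0ℓ) (L : List Carrier) →
    (∀ g → ∃ λ h → h ∈ L × K (h \\ g)) → Generates G (K ∪ (_∈ L))
  generates-∪-cosetReps K L reps g with reps g
  ... | h , h∈L , k = gen-≈ (\\-leftDividesˡ h g) (gen-∙ (gen (inj₂ h∈L)) (gen (inj₁ k)))

  generates-without-nongenerators : ∀ (K : Pred Carrier 0ℓ) (L : List Carrier) →
    All (Frattini G) L → Generates G (K ∪ (_∈ L)) → Generates G K
  generates-without-nongenerators K [] [] generates x =
    Gen-bind (λ { (inj₁ k) → gen k ; (inj₂ ()) }) (generates x)
  generates-without-nongenerators K (h ∷ L) (h-nongen ∷ L-nongen) generates =
    generates-without-nongenerators K L L-nongen (h-nongen (K ∪ (_∈ L)) λ x →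
      Gen-bind (λ { (inj₁ k)         → gen (inj₁ (inj₁ k))
                  ; (inj₂ (here e))  → gen (inj₂ e)
                  ; (inj₂ (there e)) → gen (inj₁ (inj₂ e)) })
               (generates x))

module Action {G : Group 0ℓ 0ℓ} {n : ℕ} {act : Group.Carrier G → Fin n → Fin n}
              (isAction : IsFaithfulAction G n act) where
  open Group G using (Carrier; _⁻¹; _\\_; inverseˡ; setoid)
  open IsFaithfulAction isAction
  open Generation G
  open import Data.List.Membership.Setoid setoid using (_∈_)

  act-inverseˡ : ∀ g x → act (g ⁻¹) (act g x) ≡ x
  act-inverseˡ g x = trans (sym (act-∙ (g ⁻¹) g x)) (trans (act-≈ (inverseˡ g) x) (act-ε x))

  Invariant : (Fin n → Fin n → Set) → Set
  Invariant T = ∀ g {x y} → T x y → T (act g x) (act g y)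

  Star-invariant : ∀ {T} → Invariant T → Invariant (Star T)
  Star-invariant T-inv g = gmap (act g) (T-inv g)

  Reaches : (Fin n → Fin n → Set) → Fin n → Pred Carrier 0ℓ
  Reaches T x g = Star T x (act g x)

  Reaches-isSubgroup : ∀ {T} → Symmetric T → Invariant T → ∀ x → IsSubgroup G (Reaches T x)
  Reaches-isSubgroup {T} T-sym T-inv x = record
    { resp      = λ g≈h → subst (Star T x) (act-≈ g≈h x)
    ; has-ε     = subst (Star T x) (sym (act-ε x)) ε
    ; ∙-closed  = λ {g} {h} x↝gx x↝hx →
        subst (Star T x) (sym (act-∙ g h x)) (x↝gx ◅◅ Star-invariant T-inv g x↝hx)
    ; ⁻¹-closed = λ {g} x↝gx →
        reverse T-sym (subst (Star T (act (g ⁻¹) x)) (act-inverseˡ g x)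
                             (Star-invariant T-inv (g ⁻¹) x↝gx))
    }

  Reaches-\\ : ∀ {T} → Invariant T → ∀ {x} g h →
    Star T (act g x) (act h x) → Reaches T x (g \\ h)
  Reaches-\\ {T} T-inv {x} g h gx↝hx =
    subst (λ v → Star T v (act (g \\ h) x)) (act-inverseˡ g x)
      (subst (Star T _) (sym (act-∙ (g ⁻¹) h x)) (Star-invariant T-inv (g ⁻¹) gx↝hx))

  connected-by-nongenerators : ∀ {T} → Symmetric T → Invariant T →
    (∀ x y → ∃ λ g → act g x ≡ y) → ∀ x →
    (∀ y → ∃ λ h → Frattini G h × Star T (act h x) y) → Connected T
  connected-by-nongenerators {T} T-sym T-inv transitive x near y z =
    reverse T-sym (x↝ y) ◅◅ x↝ z
    where
    rep : Fin n → Carrier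
    rep y = proj₁ (near y)

    reps : List Carrier
    reps = map rep (allFin n)

    rep∈reps : ∀ y → rep y ∈ reps
    rep∈reps y = Any.map (λ { refl → Group.refl G }) (∈-map⁺ rep (∈-allFin y))

    cosetReps : ∀ g → ∃ λ h → h ∈ reps × Reaches T x (h \\ g)
    cosetReps g = rep (act g x) , rep∈reps (act g x)
                , Reaches-\\ T-inv (rep (act g x)) g (proj₂ (proj₂ (near (act g x))))

    Reaches-generates : Generates G (Reaches T x)
    Reaches-generates = generates-without-nongenerators (Reaches T x) reps
      (map⁺ (universal (λ y → proj₁ (proj₂ (near y))) (allFin n)))
      (generates-∪-cosetReps (Reaches T x) reps cosetReps)

    x↝ : ∀ y → Star T x y
    x↝ y with transitive x y
    ... | g , refl = Gen-closed (Reaches-isSubgroup T-sym T-inv x) (Reaches-generates g)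

module QuotientLift {G : Group 0ℓ 0ℓ} {n : ℕ} {act : Group.Carrier G → Fin n → Fin n}
                    (isAction : IsFaithfulAction G n act)
                    {H : Pred (Group.Carrier G) 0ℓ} (H-sub : IsSubgroup G H) where
  open Group G using (_∙_; _⁻¹)
  open IsFaithfulAction isAction
  open IsSubgroup H-sub
  open Action isAction

  Orbit : Fin n → Fin n → Set
  Orbit = OrbitRel G act H

  orbit-sym : Symmetric Orbit
  orbit-sym {x} (h , h∈H , refl) = h ⁻¹ , ⁻¹-closed h∈H , act-inverseˡ h x

  lift-path : ∀ {E Y : Fin n → Fin n → Set} → Invariant (E ∩ Y) →
    (∀ {x y} → Y x y → QuotientAdj act H E x y) →
    (∀ {x x′ y y′} → Orbit x x′ → Orbit y y′ → Y x y → Y x′ y′) →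
    ∀ {x y} → Star (λ a b → Y a b ⊎ Orbit a b) x y →
    ∃ λ h → H h × Star (E ∩ Y) (act h x) y
  lift-path {E} {Y} EY-inv Y⊆ Y-resp {x} = lift near-start
    where
    NearOrbit : Fin n → Set
    NearOrbit a = ∃ λ h → H h × Star (E ∩ Y) (act h x) a

    near-start : NearOrbit x
    near-start = Group.ε G , has-ε , subst (λ v → Star (E ∩ Y) v x) (sym (act-ε x)) ε

    near-orbit : ∀ {a b} → Orbit a b → NearOrbit a → NearOrbit b
    near-orbit {a} (g , g∈H , refl) (h , h∈H , hx↝a) =
      g ∙ h , ∙-closed g∈H h∈H ,
      subst (λ v → Star (E ∩ Y) v (act g a)) (sym (act-∙ g h x))
            (Star-invariant EY-inv g hx↝a)

    near-edge : ∀ {a b} → (E ∩ Y) a b → NearOrbit a → NearOrbit b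
    near-edge EYab (h , h∈H , hx↝a) = h , h∈H , hx↝a ◅◅ (EYab ◅ ε)

    near-step : ∀ {a b} → Y a b ⊎ Orbit a b → NearOrbit a → NearOrbit b
    near-step (inj₂ a~b) = near-orbit a~b
    near-step (inj₁ Yab) near with Y⊆ Yab
    ... | a′ , b′ , a~a′ , b~b′ , Ea′b′ =
      near-orbit (orbit-sym b~b′)
        (near-edge (Ea′b′ , Y-resp a~a′ b~b′ Yab) (near-orbit a~a′ near))

    lift : ∀ {a b} → NearOrbit a → Star (λ a b → Y a b ⊎ Orbit a b) a b → NearOrbit b
    lift near ε = near
    lift near (step ◅ path) = lift (near-step step near) path

-- Only the symmetry of X, the transitivity of G and H ⊆ Φ(G) are used.
lemma3p5 : (n : ℕ) (E : Fin n → Fin n → Set) →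
    IsSimpleGraph E → Connected E → VertexTransitive E → 3 ≤ n →
    (G : Group 0ℓ 0ℓ) (act : Group.Carrier G → Fin n → Fin n) →
    IsFaithfulAction G n act →
    (∀ g x y → E x y ⇔ E (act g x) (act g y)) →
    (∀ x y → ∃ λ g → act g x ≡ y) →
    (p k : ℕ) → Prime p → IsCyclicOfOrder G (Derived G) (p ^ k) →
    GMinimal act _≡_ E →
    (H : Group.Carrier G → Set) → IsNormalSubgroup G H →
    (∀ h → H h → Frattini G h) →
    GMinimal act (OrbitRel G act H) (QuotientAdj act H E)
lemma3p5 n E simple _ _ _ G act isAction E-inv transitive _ _ _ _ minimal H normal nongen
         Y Y⊆ Y-resp Y-sym Y-conn Y-inv x y (x′ , y′ , x~x′ , y~y′ , Ex′y′) =
  Y-resp (orbit-sym x~x′) (orbit-sym y~y′) (proj₂ (EY-complete x′ y′ Ex′y′))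
  where
  open Action isAction
  open QuotientLift isAction (IsNormalSubgroup.isSubgroup normal)

  EY-inv⇔ : ∀ g a b → (E ∩ Y) a b ⇔ (E ∩ Y) (act g a) (act g b)
  EY-inv⇔ g a b = E-inv g a b ×-⇔ Y-inv g a b

  EY-inv : Invariant (E ∩ Y)
  EY-inv g = Equivalence.to (EY-inv⇔ g _ _)

  EY-sym : Symmetric (E ∩ Y)
  EY-sym (Eab , Yab) = IsSimpleGraph.sym simple Eab , Y-sym Yab

  EY-connected : ∀ a b → Star (λ u v → (E ∩ Y) u v ⊎ u ≡ v) a b
  EY-connected a b = gmap id inj₁
    (connected-by-nongenerators EY-sym EY-inv transitive x
      (λ v → let h , h∈H , hx↝v = lift-path EY-inv Y⊆ Y-resp (Y-conn x v)
             in h , nongen h h∈H , hx↝v) a b)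

  EY-complete : ∀ a b → E a b → (E ∩ Y) a b
  EY-complete = minimal (E ∩ Y) proj₁ (λ { refl refl → id }) EY-sym EY-connected EY-inv⇔
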